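{- Let $p$ be an odd prime. If $\lambda$ is a BG-partition, then $\lambda^{(1)*}$ is a BG-partition.
   Context: A partition is a weakly decreasing sequence $\lambda=(\lambda_1\geq\lambda_2\geq\cdots)$ of nonnegative integers with finitely many nonzero terms; $\ell(\lambda)$ is the number of nonzero parts; $[\lambda]=\{(i,j):i\geq1,\ 1\leq j\leq\lambda_i\}$ (rows downward); $\lambda'$ is the conjugate; self-conjugate means $\lambda=\lambda'$. $k(\lambda)=\max\{i:\lambda_i\geq i\}$; $h^\lambda_{ij}=\lambda_i+\lambda'_j-i-j+1$. A BG-partition is a self-conjugate $\lambda$ with $p\nmid h^\lambda_{ii}$ for all $1\leq i\leq k(\lambda)$. $p$-rim: the rim is the set of $(i,j)\in[\lambda]$ with $(i+1,j+1)\notin[\lambda]$. Label rim nodes $1,2,\dots$ along the rim from $(1,\lambda_1)$ towards the bottom-left. The first $p$-segment is the rim nodes with labels $\leq p$. If the last node of a $p$-segment is in row $i<\ell(\lambda)$ and $l$ is the smallest label of a rim node in row $i+1$, the next $p$-segment is the rim nodes with labels $l,\dots,l+p-1$ (those which exist); continue until the last row. $\mathrm{Rim}_p(\lambda)$ is the union of the $p$-segments. For self-conjugate $\lambda$: $U_\lambda=\{(i,j)\in\mathrm{Rim}_p(\lambda):i\leq j\}$, $L_\lambda=\{(j,i):(i,j)\in U_\lambda\}$, $\mathrm{Rim}^*_p(\lambda)=U_\lambda\cup L_\lambda$, and $\lambda^{(1)*}$ is the partition whose Young diagram is $[\lambda]\setminus\mathrm{Rim}^*_p(\lambda)$ (this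 is again a self-conjugate partition). -}

module Defs where

open import Data.Nat using (ℕ; zero; suc; _+_; _*_; _∸_; _≤_; _<_; _≥_; _≤?_)
open import Data.Nat.Divisibility using (_∣_)
open import Data.List using (List; []; _∷_; length; filter)
open import Data.List.Relation.Unary.All using (All)
open import Data.List.Relation.Unary.Linked using (Linked)
open import Data.Product using (_×_; Σ; ∃)
open import Data.Sum using (_⊎_)
open import Relation.Nullary using (¬_)
open import Relation.Binary.PropositionalEquality using (_≡_)

IsPartition : List ℕ → Set
IsPartition l = Linked _≥_ l × All (1 ≤_) l

-- 0-indexed lookup with default 0
at : List ℕ → ℕ → ℕ
at []       _       = 0
at (x ∷ xs) zero    = x
at (x ∷ xs) (suc n) = at xs n

-- λ_i, 1-indexed (λ_0 := 0 is never used meaningfully)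
part : List ℕ → ℕ → ℕ
part l zero    = 0
part l (suc i) = at l i

len : List ℕ → ℕ
len = length

conjPart : List ℕ → ℕ → ℕ
conjPart l j = length (filter (λ x → j ≤? x) l)

SelfConjugate : List ℕ → Set
SelfConjugate l = ∀ j → 1 ≤ j → part l j ≡ conjPart l j

InDiagram : List ℕ → ℕ → ℕ → Set
InDiagram l i j = 1 ≤ i × 1 ≤ j × j ≤ part l i

hook : List ℕ → ℕ → ℕ → ℕ
hook l i j = (part l i + conjPart l j + 1) ∸ (i + j)

-- BG-partition: self-conjugate, and p ∤ h_{ii} for 1 ≤ i ≤ k(λ),
-- where {i ≥ 1 : i ≤ k(λ)} = {i ≥ 1 : λ_i ≥ i}.
BG : ℕ → List ℕ → Set
BG p l = SelfConjugate l × (∀ i → 1 ≤ i → i ≤ part l i → ¬ (p ∣ hook l i i))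

InRim : List ℕ → ℕ → ℕ → Set
InRim l i j = InDiagram l i j × ¬ InDiagram l (suc i) (suc j)

-- label of a rim node along the rim starting from (1,λ₁) labelled 1:
-- label(i,j) = λ₁ - j + i   (rim nodes have distinct contents j - i)
label : List ℕ → ℕ → ℕ → ℕ
label l i j = (part l 1 ∸ j) + i

data SegStart (p : ℕ) (l : List ℕ) : ℕ → Set where
  first : SegStart p l 1
  next  : ∀ {s} i j → SegStart p l s →
          InRim l i j → label l i j ≡ s + p ∸ 1 → i < len l →
          -- smallest label of a rim node in row i+1 is that of (i+1, λ_{i+1})
          SegStart p l (label l (suc i) (part l (suc i)))

InRimP : ℕ → List ℕ → ℕ → ℕ → Set
InRimP p l i j = InRim l i j ×
  ∃ λ s → SegStart p l s × s ≤ label l i j × label l i j ≤ s + p ∸ 1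

InRimStar : ℕ → List ℕ → ℕ → ℕ → Set
InRimStar p l i j = (InRimP p l i j × i ≤ j) ⊎ (InRimP p l j i × j ≤ i)

IsLambda1Star : ℕ → List ℕ → List ℕ → Set
IsLambda1Star p l μ = IsPartition μ ×
  (∀ i j → (InDiagram μ i j → InDiagram l i j × ¬ InRimStar p l i j)
         × (InDiagram l i j × ¬ InRimStar p l i j → InDiagram μ i j))

module Submission where

-- Self-conjugacy of μ = λ^{(1)*} is immediate: [λ] is symmetric because λ is
-- self-conjugate, and Rim*_p(λ) = U_λ ∪ L_λ, with L_λ the transpose of U_λ,
-- is symmetric by construction.
--
-- For the diagonal hooks, let row i of μ end at (i, x+i), so h^μ_{ii} = 2x+1,
-- and suppose p ∣ 2x+1.  The node (i, x+i+1) is either outside [λ] or in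
-- Rim*_p(λ).  In the first case (i, x+i) ends row i of λ, and the end of
-- every row lies in Rim_p(λ) (p-segments start at row ends and leave no gap
-- between consecutive row ends), so (i, x+i) would have been removed.  In the
-- second case (i, x+i+1) ∈ Rim_p(λ), and either
--   * λ_{i+1} = x+i+1, so h^λ_{i+1,i+1} = 2x+1;
--   * (i, x+i) lies in the same p-segment, so it would have been removed; or
--   * (i, x+i+1) ends a p-segment, which starts at the end of some row r;
--     counting labels gives λ_r = (x+p)+r, so h^λ_{rr} = 2(x+p)+1.
-- Each case contradicts λ being BG.

open import Defs
open import Data.Nat using (ℕ; zero; suc; _+_; _∸_; _≤_; _<_; _≥_; _≤?_; z≤n; s≤s; >-nonZero⁻¹)
open import Data.Nat.Properties
open import Data.Nat.Divisibility using (_∣_; ∣m∣n⇒∣m+n; ∣-refl)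
open import Data.Nat.Primality using (Prime; prime⇒nonZero)
open import Data.Nat.Tactic.RingSolver using (solve-∀)
open import Data.List using (List; []; _∷_; length)
open import Data.List.Properties using (filter-accept; filter-reject)
open import Data.List.Relation.Unary.All using (_∷_)
open import Data.List.Relation.Unary.Linked using (Linked; _∷_; tail)
open import Data.Product using (_×_; ∃; _,_; proj₁; proj₂)
open import Data.Sum using (inj₁; inj₂)
open import Data.Empty using (⊥-elim)
open import Relation.Nullary using (¬_; yes; no)
open import Relation.Binary.PropositionalEquality
  using (_≡_; refl; sym; trans; cong; subst; module ≡-Reasoning)
open ≡-Reasoning

part-suc≤ : ∀ l → Linked _≥_ l → ∀ i → part l (suc (suc i)) ≤ part l (suc i)
part-suc≤ []           _          _       = z≤n
part-suc≤ (x ∷ [])     _          _       = z≤n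
part-suc≤ (x ∷ y ∷ ys) (x≥y ∷ _)  zero    = x≥y
part-suc≤ (x ∷ y ∷ ys) (_ ∷ lk)   (suc i) = part-suc≤ (y ∷ ys) lk i

part≤first : ∀ l → Linked _≥_ l → ∀ i → part l i ≤ part l 1
part≤first l lk zero          = z≤n
part≤first l lk (suc zero)    = ≤-refl
part≤first l lk (suc (suc i)) = ≤-trans (part-suc≤ l lk i) (part≤first l lk (suc i))

part-pos : ∀ {l i} → IsPartition l → suc i ≤ length l → 1 ≤ part l (suc i)
part-pos {x ∷ xs} {zero}  (_ , px ∷ _)  _         = px
part-pos {x ∷ xs} {suc i} (lk , _ ∷ ps) (s≤s row) = part-pos (tail lk , ps) row

part-pos⇒row : ∀ l i → 1 ≤ part l (suc i) → suc i ≤ length l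
part-pos⇒row (x ∷ xs) zero    _   = s≤s z≤n
part-pos⇒row (x ∷ xs) (suc i) pos = s≤s (part-pos⇒row xs i pos)

conj-cons-≤ : ∀ x xs j → j ≤ x → conjPart (x ∷ xs) j ≡ suc (conjPart xs j)
conj-cons-≤ x xs j j≤x = cong length (filter-accept (j ≤?_) j≤x)

conj-cons-≰ : ∀ x xs j → ¬ j ≤ x → conjPart (x ∷ xs) j ≡ conjPart xs j
conj-cons-≰ x xs j j≰x = cong length (filter-reject (j ≤?_) j≰x)

duality : ∀ l → IsPartition l → ∀ i j → 1 ≤ j →
  (j ≤ part l (suc i) → suc i ≤ conjPart l j) × (suc i ≤ conjPart l j → j ≤ part l (suc i))
duality []       _             i (suc j) _  = (λ ()) , (λ ())
duality (x ∷ xs) (lk , _ ∷ ps) i j       j1 with j ≤? x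
... | yes j≤x rewrite conj-cons-≤ x xs j j≤x = row i
  where
  row : ∀ i → (j ≤ part (x ∷ xs) (suc i) → suc i ≤ suc (conjPart xs j))
            × (suc i ≤ suc (conjPart xs j) → j ≤ part (x ∷ xs) (suc i))
  row zero    = (λ _ → s≤s z≤n) , (λ _ → j≤x)
  row (suc i) = (λ h → s≤s (proj₁ ih h)) , (λ h → proj₂ ih (≤-pred h))
    where ih = duality xs (tail lk , ps) i j j1
... | no j≰x rewrite conj-cons-≰ x xs j j≰x =
  (λ h → ⊥-elim (j≰x (≤-trans h (part≤first (x ∷ xs) lk (suc i))))) ,
  (λ h → ⊥-elim (j≰x (≤-trans (proj₂ (duality xs (tail lk , ps) zero j j1) (≤-trans (s≤s z≤n) h))
                      (part-suc≤ (x ∷ xs) lk zero))))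

selfConj⇒symmetric : ∀ l → IsPartition l → SelfConjugate l →
  ∀ i j → InDiagram l i j → InDiagram l j i
selfConj⇒symmetric l pl sc (suc i) j (i1 , j1 , j≤λi) =
  j1 , i1 , subst (suc i ≤_) (sym (sc j j1)) (proj₁ (duality l pl i j j1) j≤λi)

≤-byPositives : ∀ a b → (∀ i → 1 ≤ i → i ≤ a → i ≤ b) → a ≤ b
≤-byPositives zero    b _ = z≤n
≤-byPositives (suc a) b f = f (suc a) (s≤s z≤n) ≤-refl

symmetric⇒selfConj : ∀ μ → IsPartition μ → (∀ i j → InDiagram μ i j → InDiagram μ j i) →
  SelfConjugate μ
symmetric⇒selfConj μ pμ symm j j1 =
  ≤-antisym (≤-byPositives _ _ rowToColumn) (≤-byPositives _ _ columnToRow)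
  where
  rowToColumn : ∀ i → 1 ≤ i → i ≤ part μ j → i ≤ conjPart μ j
  rowToColumn (suc i) i1 h = proj₁ (duality μ pμ i j j1) (proj₂ (proj₂ (symm j (suc i) (j1 , i1 , h))))
  columnToRow : ∀ i → 1 ≤ i → i ≤ conjPart μ j → i ≤ part μ j
  columnToRow (suc i) i1 h = proj₂ (proj₂ (symm (suc i) j (i1 , j1 , proj₂ (duality μ pμ i j j1) h)))

diagonalHook : ∀ l → SelfConjugate l → ∀ r y → 1 ≤ r → part l r ≡ y + r → hook l r r ≡ y + y + 1
diagonalHook l sc r y r1 λr≡ = begin
  (part l r + conjPart l r + 1) ∸ (r + r)   ≡⟨ cong (λ c → (part l r + c + 1) ∸ (r + r)) (sym (sc r r1)) ⟩
  (part l r + part l r + 1) ∸ (r + r)       ≡⟨ cong (λ a → (a + a + 1) ∸ (r + r)) λr≡ ⟩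
  (y + r + (y + r) + 1) ∸ (r + r)           ≡⟨ cong (_∸ (r + r)) (regroup y r) ⟩
  (y + y + 1) + (r + r) ∸ (r + r)           ≡⟨ m+n∸n≡m (y + y + 1) (r + r) ⟩
  y + y + 1                                 ∎
  where
  regroup : ∀ y r → y + r + (y + r) + 1 ≡ (y + y + 1) + (r + r)
  regroup = solve-∀

bg-noBadArm : ∀ p l → BG p l → ∀ r y → 1 ≤ r → part l r ≡ y + r → ¬ p ∣ y + y + 1
bg-noBadArm p l (sc , bgHooks) r y r1 λr≡ p∣ =
  bgHooks r r1 (subst (r ≤_) (sym λr≡) (m≤n+m r y))
          (subst (p ∣_) (sym (diagonalHook l sc r y r1 λr≡)) p∣)

label+col : ∀ l i j → j ≤ part l 1 → label l i j + j ≡ part l 1 + i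
label+col l i j j≤A = begin
  (part l 1 ∸ j) + i + j    ≡⟨ swap (part l 1 ∸ j) i j ⟩
  (part l 1 ∸ j) + j + i    ≡⟨ cong (_+ i) (m∸n+n≡m j≤A) ⟩
  part l 1 + i              ∎
  where
  swap : ∀ a i j → a + i + j ≡ a + j + i
  swap = solve-∀

label-char : ∀ l i j c → j ≤ part l 1 → c + j ≡ part l 1 + i → label l i j ≡ c
label-char l i j c j≤A eq = +-cancelʳ-≡ j _ _ (trans (label+col l i j j≤A) (sym eq))

label-step : ∀ l i m → suc m ≤ part l 1 → label l i m ≡ suc (label l i (suc m))
label-step l i m sm≤A = label-char l i m _ (≤-trans (n≤1+n m) sm≤A)
  (trans (sym (+-suc (label l i (suc m)) m)) (label+col l i (suc m) sm≤A))

module Segments (p' : ℕ) (l : List ℕ) (pl : IsPartition l) where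

  P : ℕ
  P = suc p'

  last : ℕ → ℕ
  last s = s + P ∸ 1

  last≡ : ∀ s → last s ≡ s + p'
  last≡ s = cong (_∸ 1) (+-suc s p')

  col≤first : ∀ {i j} → InDiagram l i j → j ≤ part l 1
  col≤first {i} (_ , _ , j≤λi) = ≤-trans j≤λi (part≤first l (proj₁ pl) i)

  -- label of the last node (i, λ_i) of row i = n+1
  rowEnd : ℕ → ℕ
  rowEnd n = label l (suc n) (part l (suc n))

  rowEnd-first : rowEnd zero ≡ 1
  rowEnd-first = cong (_+ 1) (n∸n≡0 (part l 1))

  rowEnd-mono : ∀ n → rowEnd n ≤ rowEnd (suc n)
  rowEnd-mono n = +-mono-≤ (∸-monoʳ-≤ (part l 1) (part-suc≤ l (proj₁ pl) n)) (n≤1+n (suc n))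

  segStart-rowEnd : ∀ {s} → SegStart P l s → ∃ λ r → 1 ≤ r × s ≡ label l r (part l r)
  segStart-rowEnd first                = 1 , s≤s z≤n , sym rowEnd-first
  segStart-rowEnd (next i _ _ _ _ _)   = suc i , s≤s z≤n , refl

  -- Arithmetic behind rimNodeWithLabel: the column lengths match the label gaps.
  between-rows : ∀ a b L₁ L₂ N d e t → a + L₁ ≡ N → b + L₂ ≡ suc N →
    a + d ≡ t → suc t + e ≡ b → L₁ ≡ (L₂ + e) + d
  between-rows a _ L₁ L₂ _ d e _ refl h refl refl =
    +-cancelˡ-≡ a _ _ (trans (sym (suc-injective h)) (regroup a d e L₂))
    where
    regroup : ∀ a d e L₂ → a + d + e + L₂ ≡ a + ((L₂ + e) + d)
    regroup = solve-∀

  rimNodeWithLabel : ∀ n t → suc (suc n) ≤ length l → rowEnd n ≤ t → t < rowEnd (suc n) →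
    ∃ λ j → InRim l (suc n) j × label l (suc n) j ≡ t
  rimNodeWithLabel n t row lo hi with m≤n⇒∃[o]m+o≡n lo | m≤n⇒∃[o]m+o≡n hi
  ... | d , gapBelow | e , gapAbove = L₂ + e , rim , labelEq
    where
    A L₁ L₂ j : ℕ
    A  = part l 1
    L₁ = part l (suc n)
    L₂ = part l (suc (suc n))
    j  = L₂ + e
    L₁≡ : L₁ ≡ j + d
    L₁≡ = between-rows (rowEnd n) (rowEnd (suc n)) L₁ L₂ (A + suc n) d e t
            (label+col l (suc n) L₁ (part≤first l (proj₁ pl) (suc n)))
            (trans (label+col l (suc (suc n)) L₂ (part≤first l (proj₁ pl) (suc (suc n)))) (+-suc A (suc n)))
            gapBelow gapAbove
    rim : InRim l (suc n) j
    rim = (s≤s z≤n , ≤-trans (part-pos pl row) (m≤m+n L₂ e) , subst (j ≤_) (sym L₁≡) (m≤m+n j d))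
        , λ (_ , _ , sj≤L₂) → <⇒≱ sj≤L₂ (m≤m+n L₂ e)
    labelEq : label l (suc n) j ≡ t
    labelEq = label-char l (suc n) j t (≤-trans (m≤m+n j d) (subst (_≤ A) L₁≡ (part≤first l (proj₁ pl) (suc n))))
      (begin
        t + j                ≡⟨ cong (_+ j) (sym gapBelow) ⟩
        rowEnd n + d + j     ≡⟨ +-assoc (rowEnd n) d j ⟩
        rowEnd n + (d + j)   ≡⟨ cong (rowEnd n +_) (trans (+-comm d j) (sym L₁≡)) ⟩
        rowEnd n + L₁        ≡⟨ label+col l (suc n) L₁ (part≤first l (proj₁ pl) (suc n)) ⟩
        A + suc n            ∎)

  rowEnd-segment : ∀ n → suc n ≤ length l →
    ∃ λ s → SegStart P l s × s ≤ rowEnd n × rowEnd n ≤ last s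
  rowEnd-segment zero _ =
    1 , first , subst (1 ≤_) (sym rowEnd-first) ≤-refl , subst (_≤ P) (sym rowEnd-first) (s≤s z≤n)
  rowEnd-segment (suc n) row with rowEnd-segment n (<⇒≤ row)
  ... | s , seg , lo , hi with rowEnd (suc n) ≤? last s
  ...   | yes inside = s , seg , ≤-trans lo (rowEnd-mono n) , inside
  ...   | no beyond with rimNodeWithLabel n (last s) row hi (≰⇒> beyond)
  ...     | j , rim , ends =
    rowEnd (suc n) , next (suc n) j seg rim ends row , ≤-refl ,
    subst (rowEnd (suc n) ≤_) (sym (last≡ (rowEnd (suc n)))) (m≤m+n _ p')

  rowEnd-inRimP : ∀ n → suc n ≤ length l → InRimP P l (suc n) (part l (suc n))
  rowEnd-inRimP n row =
    ((s≤s z≤n , part-pos pl row , ≤-refl) ,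
     λ (_ , _ , h) → n≮n _ (≤-trans h (part-suc≤ l (proj₁ pl) n))) ,
    rowEnd-segment n row

rimStar-sym : ∀ p l i j → InRimStar p l i j → InRimStar p l j i
rimStar-sym p l i j (inj₁ u) = inj₂ u
rimStar-sym p l i j (inj₂ v) = inj₁ v

lambda1Star-selfConj : ∀ p l → IsPartition l → SelfConjugate l →
  ∀ μ → IsLambda1Star p l μ → SelfConjugate μ
lambda1Star-selfConj p l pl sc μ (pμ , [μ]≡) = symmetric⇒selfConj μ pμ symm
  where
  symm : ∀ i j → InDiagram μ i j → InDiagram μ j i
  symm i j ij∈μ with proj₁ ([μ]≡ i j) ij∈μ
  ... | ij∈λ , ij∉rim = proj₂ ([μ]≡ j i)
    (selfConj⇒symmetric l pl sc i j ij∈λ , λ ji∈rim → ij∉rim (rimStar-sym p l j i ji∈rim))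

module DiagonalHooks (p' : ℕ) (l : List ℕ) (pl : IsPartition l) (bg : BG (suc p') l) where
  open Segments p' l pl

  rowEnd-inRimStar : ∀ i m → i ≤ m → InDiagram l i m → ¬ suc m ≤ part l i → InRimStar P l i m
  rowEnd-inRimStar (suc n) m i≤m (_ , m1 , m≤λ) notLonger =
    inj₁ (subst (InRimP P l (suc n)) λ≡m (rowEnd-inRimP n (part-pos⇒row l n (≤-trans m1 m≤λ))) , i≤m)
    where
    λ≡m : part l (suc n) ≡ m
    λ≡m = ≤-antisym (≤-pred (≰⇒> notLonger)) m≤λ

  segmentEnd-arm : ∀ i x s r → suc (x + i) ≤ part l 1 →
    label l i (suc (x + i)) ≡ s + p' → s ≡ label l r (part l r) → part l r ≡ (x + P) + r
  segmentEnd-arm i x s r sm≤A endLabel startLabel = +-cancelˡ-≡ s _ _ (begin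
    s + part l r                 ≡⟨ cong (_+ part l r) startLabel ⟩
    label l r (part l r) + part l r ≡⟨ label+col l r (part l r) (part≤first l (proj₁ pl) r) ⟩
    A + r                        ≡⟨ cong (_+ r) A≡ ⟩
    (s + p' + suc x) + r         ≡⟨ regroup s p' x r ⟩
    s + ((x + P) + r)            ∎)
    where
    regroup : ∀ s p' x r → s + p' + suc x + r ≡ s + ((x + suc p') + r)
    regroup = solve-∀
    regroup′ : ∀ s p' x i → s + p' + suc (x + i) ≡ s + p' + suc x + i
    regroup′ = solve-∀
    A : ℕ
    A = part l 1
    A≡ : A ≡ s + p' + suc x
    A≡ = +-cancelʳ-≡ i _ _ (begin
      A + i                                 ≡⟨ sym (label+col l i (suc (x + i)) sm≤A) ⟩
      label l i (suc (x + i)) + suc (x + i) ≡⟨ cong (_+ suc (x + i)) endLabel ⟩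
      s + p' + suc (x + i)                  ≡⟨ regroup′ s p' x i ⟩
      s + p' + suc x + i                    ∎)

  rimStep : ∀ i x → 1 ≤ i → InRimP P l i (suc (x + i)) → InRim l i (x + i) →
    ¬ InRimStar P l i (x + i) → ¬ P ∣ x + x + 1
  rimStep i x i1 (rimNext , s , seg , lo , hi) rimHere notStar p∣
    with label l i (x + i) ≤? last s
  ... | yes inside = notStar (inj₁ ((rimHere , s , seg , s≤here , inside) , m≤n+m i x))
    where
    s≤here : s ≤ label l i (x + i)
    s≤here = subst (s ≤_) (sym (label-step l i (x + i) (col≤first (proj₁ rimNext))))
                   (≤-trans lo (n≤1+n _))
  ... | no beyond with segStart-rowEnd seg
  ...   | r , r1 , startLabel =
    bg-noBadArm P l bg r (x + P) r1 (segmentEnd-arm i x s r sm≤A endLabel startLabel)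
      (subst (P ∣_) (twice x P) (∣m∣n⇒∣m+n p∣ (∣m∣n⇒∣m+n ∣-refl ∣-refl)))
    where
    sm≤A : suc (x + i) ≤ part l 1
    sm≤A = col≤first (proj₁ rimNext)
    endLabel : label l i (suc (x + i)) ≡ s + p'
    endLabel = trans (≤-antisym hi (≤-pred (subst (last s <_) (label-step l i (x + i) sm≤A) (≰⇒> beyond))))
                     (last≡ s)
    twice : ∀ x P → (x + x + 1) + (P + P) ≡ (x + P) + (x + P) + 1
    twice = solve-∀

  -- Main step: if the diagonal row i of μ = λ^{(1)*} ends at (i, x+i) then p ∤ 2x+1.
  -- The two hypotheses say (i, x+i) ∈ [μ] and (i, x+i+1) ∉ [μ].
  diagonalRowEnd : ∀ i x → 1 ≤ i →
    InDiagram l i (x + i) × ¬ InRimStar P l i (x + i) →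
    ¬ (InDiagram l i (suc (x + i)) × ¬ InRimStar P l i (suc (x + i))) →
    ¬ P ∣ x + x + 1
  diagonalRowEnd i x i1 (here∈λ , notStar) notNext p∣ with suc (x + i) ≤? part l i
  ... | no rowEnds = notStar (rowEnd-inRimStar i (x + i) (m≤n+m i x) here∈λ rowEnds)
  ... | yes longer = notNext ((i1 , s≤s z≤n , longer) , nextNotInStar)
    where
    nextNotInStar : ¬ InRimStar P l i (suc (x + i))
    nextNotInStar (inj₂ (_ , sm≤i)) = n≮n i (≤-trans (s≤s (m≤n+m i x)) sm≤i)
    nextNotInStar (inj₁ (nextInRimP , _)) with suc (x + i) ≤? part l (suc i)
    ... | yes belowLonger = bg-noBadArm P l bg (suc i) x (s≤s z≤n) λ≡ p∣
      where
      λ≡ : part l (suc i) ≡ x + suc i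
      λ≡ = trans (≤-antisym (≤-pred (≰⇒> (λ h → proj₂ (proj₁ nextInRimP) (s≤s z≤n , s≤s z≤n , h))))
                            belowLonger)
                 (sym (+-suc x i))
    ... | no belowShorter =
      rimStep i x i1 nextInRimP (here∈λ , λ (_ , _ , h) → belowShorter h) notStar p∣

-- Lemma 3.22.  Primality of p is only used to exclude p = 0.
lemma3p22 : (p : ℕ) → Prime p → ¬ (p ≡ 2) →
    (l : List ℕ) → IsPartition l → BG p l →
    (μ : List ℕ) → IsLambda1Star p l μ → BG p μ
lemma3p22 zero pr _ _ _ _ _ _ with >-nonZero⁻¹ 0 {{prime⇒nonZero pr}}
... | ()
lemma3p22 (suc p') _ _ l pl bg μ st = μ-selfConj , μ-diagonal
  where
  open DiagonalHooks p' l pl bg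
  μ-selfConj : SelfConjugate μ
  μ-selfConj = lambda1Star-selfConj (suc p') l pl (proj₁ bg) μ st
  μ-diagonal : ∀ i → 1 ≤ i → i ≤ part μ i → ¬ suc p' ∣ hook μ i i
  μ-diagonal i i1 i≤μi p∣ =
    diagonalRowEnd i x i1 (proj₁ (proj₂ st i (x + i)) end∈μ) next∉μ
      (subst (suc p' ∣_) (diagonalHook μ μ-selfConj i x i1 μi≡) p∣)
    where
    x : ℕ
    x = part μ i ∸ i
    μi≡ : part μ i ≡ x + i
    μi≡ = sym (m∸n+n≡m i≤μi)
    end∈μ : InDiagram μ i (x + i)
    end∈μ = i1 , ≤-trans i1 (m≤n+m i x) , ≤-reflexive (sym μi≡)
    next∉μ : ¬ (InDiagram l i (suc (x + i)) × ¬ InRimStar (suc p') l i (suc (x + i)))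
    next∉μ next∈μ = n≮n (x + i) (subst (suc (x + i) ≤_) μi≡ (proj₂ (proj₂ (proj₂ (proj₂ st i (suc (x + i))) next∈μ))))
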